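{- Let ${\cal F}=(V,E)$ be a hypergraph with $V=[n]$ and all hyperedges of size at most $d$. Then there exists a two-stage group testing algorithm that finds the defective hyperedge in $E$ and uses $O\left(\sqrt d\log|E|+d\right)$ tests.
   Context: Group testing on a hypergraph: $E$ is a family of subsets (hyperedges) of $[n]=\{1,\ldots,n\}$. An unknown hyperedge $e^*\in E$, the defective hyperedge, is the set of all defective elements. A test is a subset $T\subseteq[n]$ whose response is "yes" if $T\cap e^*\neq\emptyset$ and "no" otherwise. A two-stage algorithm performs its tests in two successive stages; all tests of a stage are decided at the beginning of the stage (the second-stage tests may depend on the first-stage responses). The algorithm finds the defective hyperedge if, for every possible $e^*\in E$, it outputs $e^*$. The number of tests is the total over both stages in the worst case; the $O(\cdot)$ hides an absolute constant. Logarithms are base 2. -}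

module Defs where

open import Data.Nat using (ℕ; zero; suc; _+_; _*_; _≤_; _≤ᵇ_)
open import Data.Bool using (Bool; if_then_else_)
open import Data.Vec using (Vec; []; _∷_; map)
open import Data.List using (List)
open import Data.List.Membership.Propositional using (_∈_)
open import Data.Fin.Subset using (Subset; _∩_)
open import Data.Fin.Subset.Properties using (nonempty?)
open import Relation.Nullary.Decidable using (⌊_⌋)
open import Relation.Binary.PropositionalEquality using (_≡_)

-- ⌈√ d ⌉ : the least s with d ≤ s * s (found by bounded search; s = d always works).
ceilSqrt : ℕ → ℕ
ceilSqrt d = go (suc d) 0
  where
  go : ℕ → ℕ → ℕ
  go zero    s = s
  go (suc k) s = if d ≤ᵇ s * s then s else go k (suc s)

response : ∀ {n} → Subset n → Subset n → Bool
response T e = ⌊ nonempty? (T ∩ e) ⌋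

responses : ∀ {n m} → Vec (Subset n) m → Subset n → Vec Bool m
responses Ts e = map (λ T → response T e) Ts

record TwoStage (n : ℕ) : Set where
  field
    m₁     : ℕ
    stage1 : Vec (Subset n) m₁
    m₂     : Vec Bool m₁ → ℕ
    stage2 : (r : Vec Bool m₁) → Vec (Subset n) (m₂ r)
    decode : (r : Vec Bool m₁) → Vec Bool (m₂ r) → Subset n

  resp1 : Subset n → Vec Bool m₁
  resp1 e = responses stage1 e

  resp2 : (e : Subset n) → Vec Bool (m₂ (resp1 e))
  resp2 e = responses (stage2 (resp1 e)) e

  output : Subset n → Subset n
  output e = decode (resp1 e) (resp2 e)

  numTests : Subset n → ℕ
  numTests e = m₁ + m₂ (resp1 e)

open TwoStage public

Finds : ∀ {n} → TwoStage n → List (Subset n) → Set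
Finds A E = ∀ e → e ∈ E → output A e ≡ e

module Submission where

-- Write s = ⌈√d⌉. A random test containing each point independently with probability
-- 1 / (4D + 2) separates two sets a, b of size at most D with probability at least
-- |a Δ b| / (16D + 8): it does so whenever it meets a ─ b and misses b, or vice versa.
-- Hence greedy batches of L tests, where L t ≥ 16D + 8, each halve the number of
-- unseparated pairs at distance at least t, and 2 L ⌈log₂ |E|⌉ tests separate them all.
-- Stage one separates all pairs of E at distance at least s, with O((d / s) log |E|)
-- = O(s log |E|) tests. The hyperedges consistent with its answers then lie within
-- distance s of one of them, c. Stage two tests the at most d singletons of c, which
-- reveal e ∩ c, together with a family separating the sets e ─ c (of size below s),
-- applied as the tests τ ─ c that miss c; this reveals e ─ c with O(s log |E|) tests.

open import Defs
open import Data.Nat using (ℕ; _+_; _*_; _≤_)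
open import Data.Nat.Logarithm using (⌈log₂_⌉)
open import Data.Product using (Σ; ∃; _×_)
open import Data.List using (List; length)
open import Data.List.Relation.Unary.All using (All)
open import Data.List.Relation.Unary.Unique.Propositional using (Unique)
open import Data.List.Membership.Propositional using (_∈_)
open import Data.Fin.Subset using (Subset; ∣_∣)

open import Data.Bool using (Bool; true; false; if_then_else_; T; _∧_; _∨_; not)
import Data.Bool as Bool
open import Data.Bool.Properties using (∧-zeroʳ; ∨-identityʳ)
open import Data.Fin using (Fin) renaming (zero to fzero; suc to fsuc)
open import Data.Fin.Subset using (inside; outside; _∩_; _∪_; _─_; ⁅_⁆; Nonempty)
  renaming (⊥ to ∅; _∈_ to _∈ₛ_)
open import Data.Fin.Subset.Properties
  using (nonempty?; ∉⊥; x∈p∩q⁻; x∈p∪q⁻; x∈p∪q⁺; ∩-distribˡ-∪; ∪-comm; ∣p─q∣≤∣p∣)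
open import Data.List using ([]; _∷_; _++_; filter; map; head)
open import Data.List.Membership.Propositional.Properties
  using (∈-filter⁺; ∈-filter⁻; ∈-map⁺; ∈-++⁺ˡ; ∈-++⁺ʳ)
open import Data.List.Properties using (length-++; length-map; length-filter)
open import Data.List.Relation.Unary.All using ([]; _∷_)
import Data.List.Relation.Unary.All as All
import Data.List.Relation.Unary.All.Properties as All
open import Data.List.Relation.Unary.All.Properties using (All¬⇒¬Any)
open import Data.List.Relation.Unary.Any using (Any; here; there)
import Data.List.Relation.Unary.Any as Any
import Data.List.Relation.Unary.Any.Properties as Any
open import Data.Maybe using (just; fromMaybe)
open import Data.Nat using (zero; suc; _<_; _∸_; _^_; _≤?_; _≤ᵇ_; _<ᵇ_; z≤n; s≤s; z<s; NonZero; >-nonZero⁻¹; ⌈_/2⌉; ⌊_/2⌋)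
open import Data.Nat.Induction using (<-wellFounded)
open import Data.Nat.Logarithm using (⌈log₂⌉-mono-≤)
open import Data.Nat.Logarithm.Core using (⌈log2⌉)
open import Data.Nat.Properties
open import Algebra.Properties.CommutativeSemigroup *-commutativeSemigroup using (x∙yz≈y∙xz)
open import Data.Nat.Tactic.RingSolver using (solve-∀)
open import Data.Product using (_,_; proj₁; proj₂)
open import Data.Sum using (_⊎_; inj₁; inj₂; [_,_]′)
import Data.Sum as Sum
open import Data.Vec using (Vec; []; _∷_; lookup; fromList; here; there)
open import Data.Vec.Properties using (∷-injective; ∷-injectiveˡ; ∷-injectiveʳ; ≡-dec)
open import Function using (_∘_)
open import Function.Bundles using (_⇔_; mk⇔)
open import Induction.WellFounded using (Acc; acc)
open import Level using (0ℓ)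
open import Relation.Binary.Definitions using (DecidableEquality)
open import Relation.Binary.PropositionalEquality
open import Relation.Nullary using (¬_; ¬?; _⊎-dec_; _×-dec_; yes; no)
open import Relation.Nullary.Decidable using (⌊_⌋; does; does-⇔; dec-false; isYes≗does)
open import Relation.Unary using (Pred; Decidable)
open import Relation.Unary.Properties using (∁?)

-- Arithmetic

module _ (search : ℕ → ℕ → ℕ → ℕ)
         (search-zero : ∀ d s → search d 0 s ≡ s)
         (search-suc : ∀ d k s → search d (suc k) s ≡ (if d ≤ᵇ s * s then s else search d k (suc s)))
         where

  search-sq : ∀ d k s → d ≤ (s + k) * (s + k) → d ≤ search d k s * search d k s
  search-sq d zero    s d≤s²      rewrite search-zero d s | +-identityʳ s = d≤s²
  search-sq d (suc k) s d≤[s+k]² rewrite search-suc d k s with d ≤ᵇ s * s in found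
  ... | true  = ≤ᵇ⇒≤ d (s * s) (subst T (sym found) _)
  ... | false = search-sq d k (suc s) (subst (λ x → d ≤ x * x) (+-suc s k) d≤[s+k]²)

  search-sq-from-2 : ∀ d y b → suc y ≡ d → (T b → y ≡ 0) →
    d ≤ (if b then 1 else search d y 2) * (if b then 1 else search d y 2)
  search-sq-from-2 _ y true  refl y≡0 rewrite y≡0 _ = ≤-refl
  search-sq-from-2 _ y false refl _ =
    search-sq (suc y) y 2 (≤-trans (n≤1+n (suc y)) (m≤m*n (2 + y) (2 + y)))

-- The search loop of ceilSqrt is where-bound, so it cannot be named here. Abstracting
-- the arguments of the loop call in the unfolded goal lets Agda solve `search` for it
-- by pattern unification; `y + 0` keeps the loop counter syntactically apart from the
-- target `suc (y + 0)`, and `search` must be introduced before the abstractions.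
ceilSqrt-sq′ : ∀ y → suc (y + 0) ≤ ceilSqrt (suc (y + 0)) * ceilSqrt (suc (y + 0))
ceilSqrt-sq′ y with search-sq-from-2 _ (λ _ _ → refl) (λ _ _ _ → refl)
... | bound with suc (y + 0) in 1+k≡d
... | d with y + 0 | 2
... | k | s = bound d k (k <ᵇ 1) 1+k≡d (λ k<1 → n<1⇒n≡0 (<ᵇ⇒< k 1 k<1))

ceilSqrt-sq : ∀ d → d ≤ ceilSqrt d * ceilSqrt d
ceilSqrt-sq zero    = z≤n
ceilSqrt-sq (suc y) = subst (λ d → d ≤ ceilSqrt d * ceilSqrt d) (cong suc (+-identityʳ y)) (ceilSqrt-sq′ y)

n≤2^⌈log2⌉n : ∀ n (rec : Acc _<_ n) → n ≤ 2 ^ ⌈log2⌉ n rec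
n≤2^⌈log2⌉n 0 _ = z≤n
n≤2^⌈log2⌉n 1 _ = ≤-refl
n≤2^⌈log2⌉n (suc (suc n)) (acc rec) = begin
  2 + n                                  ≤⟨ +-monoʳ-≤ 2 n≤2⌈n/2⌉ ⟩
  2 + 2 * ⌈ n /2⌉                        ≡⟨ *-suc 2 ⌈ n /2⌉ ⟨
  2 * suc ⌈ n /2⌉                        ≤⟨ *-monoʳ-≤ 2 (n≤2^⌈log2⌉n (suc ⌈ n /2⌉) _) ⟩
  2 * 2 ^ ⌈log2⌉ (suc ⌈ n /2⌉) _         ∎
  where
  open ≤-Reasoning
  n≤2⌈n/2⌉ : n ≤ 2 * ⌈ n /2⌉
  n≤2⌈n/2⌉ = begin
    n                       ≡⟨ ⌊n/2⌋+⌈n/2⌉≡n n ⟨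
    ⌊ n /2⌋ + ⌈ n /2⌉       ≤⟨ +-monoˡ-≤ ⌈ n /2⌉ (⌊n/2⌋≤⌈n/2⌉ n) ⟩
    ⌈ n /2⌉ + ⌈ n /2⌉       ≡⟨ cong (⌈ n /2⌉ +_) (+-identityʳ ⌈ n /2⌉) ⟨
    2 * ⌈ n /2⌉             ∎

n≤2^⌈log₂n⌉ : ∀ n → n ≤ 2 ^ ⌈log₂ n ⌉
n≤2^⌈log₂n⌉ n = n≤2^⌈log2⌉n n (<-wellFounded n)

[1+q]^m*r≤[1+q]*q^m : ∀ q m r → m + r ≡ suc q → suc q ^ m * r ≤ suc q * q ^ m
[1+q]^m*r≤[1+q]*q^m q zero r refl = ≤-reflexive (*-comm 1 (suc q))
[1+q]^m*r≤[1+q]*q^m q (suc m) r m+r≡q = begin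
  suc q * suc q ^ m * r       ≡⟨ *-assoc (suc q) (suc q ^ m) r ⟩
  suc q * (suc q ^ m * r)     ≡⟨ x∙yz≈y∙xz (suc q) (suc q ^ m) r ⟩
  suc q ^ m * (suc q * r)     ≤⟨ *-monoʳ-≤ (suc q ^ m) (+-monoˡ-≤ (q * r) r≤q) ⟩
  suc q ^ m * (q + q * r)     ≡⟨ cong (suc q ^ m *_) (*-suc q r) ⟨
  suc q ^ m * (q * suc r)     ≡⟨ x∙yz≈y∙xz (suc q ^ m) q (suc r) ⟩
  q * (suc q ^ m * suc r)     ≤⟨ *-monoʳ-≤ q ([1+q]^m*r≤[1+q]*q^m q m (suc r) (trans (+-suc m r) m+r≡q)) ⟩
  q * (suc q * q ^ m)         ≡⟨ x∙yz≈y∙xz q (suc q) (q ^ m) ⟩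
  suc q * (q * q ^ m)         ∎
  where
  open ≤-Reasoning
  r≤q : r ≤ q
  r≤q = subst (r ≤_) (suc-injective m+r≡q) (m≤n+m r m)

[1+q]^m≤2*q^m : ∀ q m → 2 * m ≤ suc q → suc q ^ m ≤ 2 * q ^ m
[1+q]^m≤2*q^m q m 2m≤1+q = *-cancelˡ-≤ (suc q) (begin
  suc q * suc q ^ m           ≡⟨ *-comm (suc q) (suc q ^ m) ⟩
  suc q ^ m * suc q           ≤⟨ *-monoʳ-≤ (suc q ^ m) 1+q≤2r ⟩
  suc q ^ m * (2 * r)         ≡⟨ x∙yz≈y∙xz (suc q ^ m) 2 r ⟩
  2 * (suc q ^ m * r)         ≤⟨ *-monoʳ-≤ 2 ([1+q]^m*r≤[1+q]*q^m q m r m+r≡1+q) ⟩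
  2 * (suc q * q ^ m)         ≡⟨ x∙yz≈y∙xz 2 (suc q) (q ^ m) ⟩
  suc q * (2 * q ^ m)         ∎)
  where
  open ≤-Reasoning
  r : ℕ
  r = suc q ∸ m
  m+m≤1+q : m + m ≤ suc q
  m+m≤1+q = subst (_≤ suc q) (cong (m +_) (+-identityʳ m)) 2m≤1+q
  m+r≡1+q : m + r ≡ suc q
  m+r≡1+q = m+[n∸m]≡n (≤-trans (m≤m+n m m) m+m≤1+q)
  1+q≤2r : suc q ≤ 2 * r
  1+q≤2r = begin
    suc q      ≡⟨ m+r≡1+q ⟨
    m + r      ≤⟨ +-monoˡ-≤ r (+-cancelˡ-≤ m m r (subst (m + m ≤_) (sym m+r≡1+q) m+m≤1+q)) ⟩
    r + r      ≡⟨ cong (r +_) (+-identityʳ r) ⟨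
    2 * r      ∎

q+m*q^m≤q*[1+q]^m : ∀ q m → (q + m) * q ^ m ≤ q * suc q ^ m
q+m*q^m≤q*[1+q]^m q zero = ≤-reflexive (cong (_* 1) (+-identityʳ q))
q+m*q^m≤q*[1+q]^m q (suc m) = begin
  (q + suc m) * (q * q ^ m)              ≤⟨ m≤m+n _ (m * q ^ m) ⟩
  (q + suc m) * (q * q ^ m) + m * q ^ m  ≡⟨ expand q m (q ^ m) ⟩
  suc q * ((q + m) * q ^ m)              ≤⟨ *-monoʳ-≤ (suc q) (q+m*q^m≤q*[1+q]^m q m) ⟩
  suc q * (q * suc q ^ m)                ≡⟨ *-assoc (suc q) q _ ⟨
  suc q * q * suc q ^ m                  ≡⟨ cong (_* suc q ^ m) (*-comm (suc q) q) ⟩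
  q * suc q * suc q ^ m                  ≡⟨ *-assoc q (suc q) _ ⟩
  q * (suc q * suc q ^ m)                ∎
  where
  open ≤-Reasoning
  expand : ∀ q m x → (q + suc m) * (q * x) + m * x ≡ suc q * ((q + m) * x)
  expand = solve-∀

-- Responses and separation

nonempty?-∷ : ∀ {n} b (p : Subset n) → ⌊ nonempty? (b ∷ p) ⌋ ≡ b ∨ ⌊ nonempty? p ⌋
nonempty?-∷ true  p = refl
nonempty?-∷ false p = begin
  ⌊ nonempty? (outside ∷ p) ⌋      ≡⟨ isYes≗does (nonempty? (outside ∷ p)) ⟩
  does (nonempty? (outside ∷ p))   ≡⟨ does-⇔ (mk⇔ drop-outside (λ (x , x∈p) → fsuc x , there x∈p)) (nonempty? (outside ∷ p)) (nonempty? p) ⟩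
  does (nonempty? p)               ≡⟨ isYes≗does (nonempty? p) ⟨
  ⌊ nonempty? p ⌋                  ∎
  where
  open ≡-Reasoning
  drop-outside : Nonempty (outside ∷ p) → Nonempty p
  drop-outside (fsuc x , there x∈p) = x , x∈p

response-∷ : ∀ {n} t x (τ e : Subset n) → response (t ∷ τ) (x ∷ e) ≡ (t ∧ x) ∨ response τ e
response-∷ t x τ e = nonempty?-∷ (t ∧ x) (τ ∩ e)

response-∅ : ∀ {n} (e : Subset n) → response ∅ e ≡ false
response-∅ e = trans (isYes≗does (nonempty? (∅ ∩ e)))
  (dec-false (nonempty? (∅ ∩ e)) (λ (x , x∈∅∩e) → ∉⊥ (proj₁ (x∈p∩q⁻ ∅ e x∈∅∩e))))

response-⁅⁆ : ∀ {n} (x : Fin n) e → response ⁅ x ⁆ e ≡ lookup e x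
response-⁅⁆ fzero    (b ∷ e) = trans (response-∷ true b ∅ e) (trans (cong (b ∨_) (response-∅ e)) (∨-identityʳ b))
response-⁅⁆ (fsuc x) (b ∷ e) = trans (response-∷ false b ⁅ x ⁆ e) (response-⁅⁆ x e)

response-∪ : ∀ {n} (τ a b : Subset n) → response τ (a ∪ b) ≡ response τ a ∨ response τ b
response-∪ τ a b = begin
  ⌊ nonempty? (τ ∩ (a ∪ b)) ⌋                           ≡⟨ cong (λ p → ⌊ nonempty? p ⌋) (∩-distribˡ-∪ τ a b) ⟩
  ⌊ nonempty? (τ ∩ a ∪ τ ∩ b) ⌋                         ≡⟨ isYes≗does (nonempty? (τ ∩ a ∪ τ ∩ b)) ⟩
  does (nonempty? (τ ∩ a ∪ τ ∩ b))                      ≡⟨ does-⇔ split (nonempty? (τ ∩ a ∪ τ ∩ b)) (nonempty? (τ ∩ a) ⊎-dec nonempty? (τ ∩ b)) ⟩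
  does (nonempty? (τ ∩ a)) ∨ does (nonempty? (τ ∩ b))   ≡⟨ cong₂ _∨_ (isYes≗does (nonempty? (τ ∩ a))) (isYes≗does (nonempty? (τ ∩ b))) ⟨
  response τ a ∨ response τ b                           ∎
  where
  open ≡-Reasoning
  split : Nonempty (τ ∩ a ∪ τ ∩ b) ⇔ (Nonempty (τ ∩ a) ⊎ Nonempty (τ ∩ b))
  split = mk⇔ (λ (x , x∈) → Sum.map (x ,_) (x ,_) (x∈p∪q⁻ (τ ∩ a) (τ ∩ b) x∈))
              (Sum.[ (λ (x , x∈) → x , x∈p∪q⁺ (inj₁ x∈)) , (λ (x , x∈) → x , x∈p∪q⁺ (inj₂ x∈)) ])

[p─q]∩r≡p∩[r─q] : ∀ {n} (p q r : Subset n) → (p ─ q) ∩ r ≡ p ∩ (r ─ q)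
[p─q]∩r≡p∩[r─q] []      []      []      = refl
[p─q]∩r≡p∩[r─q] (x ∷ p) (true  ∷ q) (z ∷ r) = cong₂ _∷_ (sym (∧-zeroʳ x)) ([p─q]∩r≡p∩[r─q] p q r)
[p─q]∩r≡p∩[r─q] (x ∷ p) (false ∷ q) (z ∷ r) = cong (x ∧ z ∷_) ([p─q]∩r≡p∩[r─q] p q r)

response-─ : ∀ {n} (τ c e : Subset n) → response (τ ─ c) e ≡ response τ (e ─ c)
response-─ τ c e = cong (λ p → ⌊ nonempty? p ⌋) ([p─q]∩r≡p∩[r─q] τ c e)

Separates : ∀ {n} → Subset n → Pred (Subset n × Subset n) 0ℓ
Separates τ (a , b) = response τ a ≢ response τ b

separates? : ∀ {n} (τ : Subset n) → Decidable (Separates τ)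
separates? τ (a , b) = ¬? (response τ a Bool.≟ response τ b)

Separated : ∀ {n} → List (Subset n) → Subset n → Subset n → Set
Separated τs a b = Any (λ τ → Separates τ (a , b)) τs

Agree : ∀ {n} → List (Subset n) → Subset n → Subset n → Set
Agree τs a b = All (λ τ → response τ a ≡ response τ b) τs

responses-≡⇒Agree : ∀ {n} (τs : List (Subset n)) {a b} →
  responses (fromList τs) a ≡ responses (fromList τs) b → Agree τs a b
responses-≡⇒Agree []       _  = []
responses-≡⇒Agree (τ ∷ τs) eq = proj₁ (∷-injective eq) ∷ responses-≡⇒Agree τs (proj₂ (∷-injective eq))

Agree⇒¬Separated : ∀ {n} {τs : List (Subset n)} {a b} → Agree τs a b → ¬ Separated τs a b
Agree⇒¬Separated agree = All¬⇒¬Any (All.map (λ same separates → separates same) agree)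

-- Sizes and distance

∣p∪q∣≡∣q∣+∣p─q∣ : ∀ {n} (p q : Subset n) → ∣ p ∪ q ∣ ≡ ∣ q ∣ + ∣ p ─ q ∣
∣p∪q∣≡∣q∣+∣p─q∣ []          []          = refl
∣p∪q∣≡∣q∣+∣p─q∣ (true  ∷ p) (true  ∷ q) = cong suc (∣p∪q∣≡∣q∣+∣p─q∣ p q)
∣p∪q∣≡∣q∣+∣p─q∣ (false ∷ p) (true  ∷ q) = cong suc (∣p∪q∣≡∣q∣+∣p─q∣ p q)
∣p∪q∣≡∣q∣+∣p─q∣ (true  ∷ p) (false ∷ q) = trans (cong suc (∣p∪q∣≡∣q∣+∣p─q∣ p q)) (sym (+-suc ∣ q ∣ ∣ p ─ q ∣))
∣p∪q∣≡∣q∣+∣p─q∣ (false ∷ p) (false ∷ q) = ∣p∪q∣≡∣q∣+∣p─q∣ p q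

∣p∪q∣≤∣p∣+∣q∣ : ∀ {n} (p q : Subset n) → ∣ p ∪ q ∣ ≤ ∣ p ∣ + ∣ q ∣
∣p∪q∣≤∣p∣+∣q∣ p q = begin
  ∣ p ∪ q ∣            ≡⟨ ∣p∪q∣≡∣q∣+∣p─q∣ p q ⟩
  ∣ q ∣ + ∣ p ─ q ∣    ≤⟨ +-monoʳ-≤ ∣ q ∣ (∣p─q∣≤∣p∣ p q) ⟩
  ∣ q ∣ + ∣ p ∣        ≡⟨ +-comm ∣ q ∣ ∣ p ∣ ⟩
  ∣ p ∣ + ∣ q ∣        ∎
  where open ≤-Reasoning

∣p∣≤0⇒p≡∅ : ∀ {n} (p : Subset n) → ∣ p ∣ ≤ 0 → p ≡ ∅
∣p∣≤0⇒p≡∅ []          _     = refl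
∣p∣≤0⇒p≡∅ (false ∷ p) ∣p∣≤0 = cong (false ∷_) (∣p∣≤0⇒p≡∅ p ∣p∣≤0)

distance : ∀ {n} → Subset n → Subset n → ℕ
distance a b = ∣ a ─ b ∣ + ∣ b ─ a ∣

distance-self : ∀ {n} (a : Subset n) → distance a a ≡ 0
distance-self []          = refl
distance-self (true  ∷ a) = distance-self a
distance-self (false ∷ a) = distance-self a

distance≡0⇒≡ : ∀ {n} (a b : Subset n) → distance a b ≡ 0 → a ≡ b
distance≡0⇒≡ []          []          _ = refl
distance≡0⇒≡ (true  ∷ a) (true  ∷ b) d≡0 = cong (true ∷_) (distance≡0⇒≡ a b d≡0)
distance≡0⇒≡ (false ∷ a) (false ∷ b) d≡0 = cong (false ∷_) (distance≡0⇒≡ a b d≡0)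
distance≡0⇒≡ (true  ∷ a) (false ∷ b) ()
distance≡0⇒≡ (false ∷ a) (true  ∷ b) d≡0 with () ← m+n≡0⇒n≡0 ∣ a ─ b ∣ d≡0

agree-outside-and-on⇒≡ : ∀ {n} (a b c : Subset n) → a ─ c ≡ b ─ c →
  (∀ x → x ∈ₛ c → lookup a x ≡ lookup b x) → a ≡ b
agree-outside-and-on⇒≡ []      []      []          _   _  = refl
agree-outside-and-on⇒≡ (x ∷ a) (y ∷ b) (true  ∷ c) a─c≡b─c on-c = cong₂ _∷_ (on-c fzero here)
  (agree-outside-and-on⇒≡ a b c (∷-injectiveʳ a─c≡b─c) (λ z z∈c → on-c (fsuc z) (there z∈c)))
agree-outside-and-on⇒≡ (x ∷ a) (y ∷ b) (false ∷ c) a─c≡b─c on-c = cong₂ _∷_ (∷-injectiveˡ a─c≡b─c)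
  (agree-outside-and-on⇒≡ a b c (∷-injectiveʳ a─c≡b─c) (λ z z∈c → on-c (fsuc z) (there z∈c)))

-- Random tests

indicator : Bool → ℕ
indicator true  = 1
indicator false = 0

length-filter-∷ : ∀ {A : Set} {P : Pred A 0ℓ} (P? : Decidable P) {x} xs →
  length (filter P? (x ∷ xs)) ≡ indicator (does (P? x)) + length (filter P? xs)
length-filter-∷ P? {x} xs with does (P? x)
... | true  = refl
... | false = refl

-- weightedSum q f is (1 + q) ^ n times the mean of f τ over a random test τ that
-- contains each point independently with probability 1 / (1 + q).
module _ (q : ℕ) where

  weightedSum : ∀ {n} → (Subset n → ℕ) → ℕ
  weightedSum {zero}  f = f []
  weightedSum {suc n} f = weightedSum (λ τ → f (inside ∷ τ)) + q * weightedSum (λ τ → f (outside ∷ τ))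

  weightedSum-cong : ∀ {n} {f g : Subset n → ℕ} → (∀ τ → f τ ≡ g τ) → weightedSum f ≡ weightedSum g
  weightedSum-cong {zero}  f≡g = f≡g []
  weightedSum-cong {suc n} f≡g =
    cong₂ (λ x y → x + q * y) (weightedSum-cong (λ τ → f≡g (inside ∷ τ))) (weightedSum-cong (λ τ → f≡g (outside ∷ τ)))

  weightedSum-mono : ∀ {n} {f g : Subset n → ℕ} → (∀ τ → f τ ≤ g τ) → weightedSum f ≤ weightedSum g
  weightedSum-mono {zero}  f≤g = f≤g []
  weightedSum-mono {suc n} f≤g =
    +-mono-≤ (weightedSum-mono (λ τ → f≤g (inside ∷ τ))) (*-monoʳ-≤ q (weightedSum-mono (λ τ → f≤g (outside ∷ τ))))

  weightedSum-+ : ∀ {n} (f g : Subset n → ℕ) → weightedSum (λ τ → f τ + g τ) ≡ weightedSum f + weightedSum g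
  weightedSum-+ {zero}  f g = refl
  weightedSum-+ {suc n} f g = begin
    weightedSum (λ τ → f (inside ∷ τ) + g (inside ∷ τ)) + q * weightedSum (λ τ → f (outside ∷ τ) + g (outside ∷ τ))
                                     ≡⟨ cong₂ (λ x y → x + q * y) (weightedSum-+ {n} _ _) (weightedSum-+ {n} _ _) ⟩
    (f₁ + g₁) + q * (f₀ + g₀)        ≡⟨ rearrange q f₁ g₁ f₀ g₀ ⟩
    (f₁ + q * f₀) + (g₁ + q * g₀)    ∎
    where
    open ≡-Reasoning
    f₁ g₁ f₀ g₀ : ℕ
    f₁ = weightedSum (λ τ → f (inside ∷ τ))
    g₁ = weightedSum (λ τ → g (inside ∷ τ))
    f₀ = weightedSum (λ τ → f (outside ∷ τ))
    g₀ = weightedSum (λ τ → g (outside ∷ τ))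
    rearrange : ∀ q a b c d → (a + b) + q * (c + d) ≡ (a + q * c) + (b + q * d)
    rearrange = solve-∀

  weightedSum-const : ∀ n c → weightedSum {n} (λ _ → c) ≡ suc q ^ n * c
  weightedSum-const zero    c = sym (+-identityʳ c)
  weightedSum-const (suc n) c = begin
    weightedSum {n} (λ _ → c) + q * weightedSum {n} (λ _ → c)  ≡⟨ cong₂ (λ x y → x + q * y) (weightedSum-const n c) (weightedSum-const n c) ⟩
    suc q * (suc q ^ n * c)                                    ≡⟨ *-assoc (suc q) (suc q ^ n) c ⟨
    suc q * suc q ^ n * c                                      ∎
    where open ≡-Reasoning

  weightedSum≤max : ∀ {n} (f : Subset n → ℕ) → ∃ λ τ → weightedSum f ≤ suc q ^ n * f τ
  weightedSum≤max {zero}  f = [] , ≤-reflexive (sym (+-identityʳ (f [])))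
  weightedSum≤max {suc n} f with weightedSum≤max (λ τ → f (inside ∷ τ)) | weightedSum≤max (λ τ → f (outside ∷ τ))
  ... | τ₁ , ws₁≤ | τ₀ , ws₀≤ =
    [ (λ f₁≤f₀ → outside ∷ τ₀ , bound f₁≤f₀ ≤-refl) , (λ f₀≤f₁ → inside ∷ τ₁ , bound ≤-refl f₀≤f₁) ]′ (≤-total f₁ f₀)
    where
    f₁ f₀ : ℕ
    f₁ = f (inside ∷ τ₁)
    f₀ = f (outside ∷ τ₀)
    bound : ∀ {w} → f₁ ≤ w → f₀ ≤ w → weightedSum f ≤ suc q * suc q ^ n * w
    bound {w} f₁≤w f₀≤w = begin
      weightedSum (λ τ → f (inside ∷ τ)) + q * weightedSum (λ τ → f (outside ∷ τ))
                                              ≤⟨ +-mono-≤ (≤-trans ws₁≤ (*-monoʳ-≤ (suc q ^ n) f₁≤w))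
                                                          (*-monoʳ-≤ q (≤-trans ws₀≤ (*-monoʳ-≤ (suc q ^ n) f₀≤w))) ⟩
      suc q * (suc q ^ n * w)                 ≡⟨ *-assoc (suc q) (suc q ^ n) w ⟨
      suc q * suc q ^ n * w                   ∎
      where open ≤-Reasoning

  avoidingWeight : ∀ {n} → Subset n → ℕ
  avoidingWeight V = weightedSum (λ τ → indicator (not (response τ V)))

  separatingWeight : ∀ {n} → Subset n × Subset n → ℕ
  separatingWeight p = weightedSum (λ τ → indicator (does (separates? τ p)))

  avoidingWeight-formula : ∀ {n} (V : Subset n) → avoidingWeight V * suc q ^ ∣ V ∣ ≡ suc q ^ n * q ^ ∣ V ∣
  avoidingWeight-formula []          = refl
  avoidingWeight-formula {suc n} (true ∷ V) = begin
    (weightedSum {n} (λ _ → 0) + q * Z₀) * (suc q * suc q ^ ∣ V ∣)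
      ≡⟨ cong₂ (λ x y → (x + q * y) * (suc q * suc q ^ ∣ V ∣))
               (trans (weightedSum-const n 0) (*-zeroʳ (suc q ^ n))) drop-head ⟩
    q * Z * (suc q * suc q ^ ∣ V ∣)          ≡⟨ rearrange q Z (suc q ^ ∣ V ∣) ⟩
    q * suc q * (Z * suc q ^ ∣ V ∣)          ≡⟨ cong (q * suc q *_) (avoidingWeight-formula V) ⟩
    q * suc q * (suc q ^ n * q ^ ∣ V ∣)     ≡⟨ rearrange′ q (suc q ^ n) (q ^ ∣ V ∣) ⟩
    suc q * suc q ^ n * (q * q ^ ∣ V ∣)     ∎
    where
    open ≡-Reasoning
    Z Z₀ : ℕ
    Z  = avoidingWeight V
    Z₀ = weightedSum (λ τ → indicator (not (response (false ∷ τ) (true ∷ V))))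
    drop-head : Z₀ ≡ Z
    drop-head = weightedSum-cong (λ τ → cong (indicator ∘ not) (response-∷ false true τ V))
    rearrange : ∀ q z x → q * z * (suc q * x) ≡ q * suc q * (z * x)
    rearrange = solve-∀
    rearrange′ : ∀ q y x → q * suc q * (y * x) ≡ suc q * y * (q * x)
    rearrange′ = solve-∀
  avoidingWeight-formula {suc n} (false ∷ V) = begin
    (Z₁ + q * Z₀) * suc q ^ ∣ V ∣          ≡⟨ cong₂ (λ x y → (x + q * y) * suc q ^ ∣ V ∣) (drop-head true) (drop-head false) ⟩
    (Z + q * Z) * suc q ^ ∣ V ∣            ≡⟨ *-assoc (suc q) Z (suc q ^ ∣ V ∣) ⟩
    suc q * (Z * suc q ^ ∣ V ∣)            ≡⟨ cong (suc q *_) (avoidingWeight-formula V) ⟩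
    suc q * (suc q ^ n * q ^ ∣ V ∣)        ≡⟨ *-assoc (suc q) (suc q ^ n) (q ^ ∣ V ∣) ⟨
    suc q * suc q ^ n * q ^ ∣ V ∣          ∎
    where
    open ≡-Reasoning
    Z Z₁ Z₀ : ℕ
    Z  = avoidingWeight V
    Z₁ = weightedSum (λ τ → indicator (not (response (true ∷ τ) (false ∷ V))))
    Z₀ = weightedSum (λ τ → indicator (not (response (false ∷ τ) (false ∷ V))))
    drop-head : ∀ t → weightedSum (λ τ → indicator (not (response (t ∷ τ) (false ∷ V)))) ≡ Z
    drop-head t = weightedSum-cong (λ τ → cong (indicator ∘ not)
      (trans (response-∷ t false τ V) (cong (_∨ response τ V) (∧-zeroʳ t))))

  avoidingWeight≤separatingWeight+avoidingWeight : ∀ {n} (a b : Subset n) →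
    avoidingWeight b ≤ separatingWeight (a , b) + avoidingWeight (a ∪ b)
  avoidingWeight≤separatingWeight+avoidingWeight {n} a b = begin
    avoidingWeight b
      ≤⟨ weightedSum-mono pointwise ⟩
    weightedSum (λ τ → indicator (does (separates? τ (a , b))) + indicator (not (response τ (a ∪ b))))
      ≡⟨ weightedSum-+ {n} _ _ ⟩
    separatingWeight (a , b) + avoidingWeight (a ∪ b)
      ∎
    where
    open ≤-Reasoning
    truth-table : ∀ x y → indicator (not y) ≤ indicator (does (¬? (x Bool.≟ y))) + indicator (not (x ∨ y))
    truth-table true  true  = z≤n
    truth-table true  false = ≤-refl
    truth-table false true  = z≤n
    truth-table false false = ≤-refl
    pointwise : ∀ τ → indicator (not (response τ b)) ≤
                      indicator (does (separates? τ (a , b))) + indicator (not (response τ (a ∪ b)))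
    pointwise τ rewrite response-∪ τ a b = truth-table (response τ a) (response τ b)

  -- A test that misses b but not a ∪ b separates a from b, so the separating weight is at
  -- least avoidingWeight b - avoidingWeight (a ∪ b) = N (q / K) ^ β (1 - (q / K) ^ m), with
  -- K = 1 + q, β = ∣ b ∣ and m = ∣ a ─ b ∣; Bernoulli's inequality bounds the last factor.
  separatingWeight-gain : ∀ {n} (a b : Subset n) →
    ∣ a ─ b ∣ * (suc q ^ n * q ^ ∣ a ∪ b ∣) ≤ q * (separatingWeight (a , b) * suc q ^ ∣ a ∪ b ∣)
  separatingWeight-gain {n} a b =
    subst (λ r → m * (N * q ^ r) ≤ q * (W * suc q ^ r)) (sym ∣a∪b∣≡β+m) (+-cancelˡ-≤ (q * (N * q ^ (β + m))) _ _ (begin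
      q * (N * q ^ (β + m)) + m * (N * q ^ (β + m))   ≡⟨ cong (λ x → q * (N * x) + m * (N * x)) (^-distribˡ-+-* q β m) ⟩
      q * (N * (qᵝ * qᵐ)) + m * (N * (qᵝ * qᵐ))       ≡⟨ split q m N qᵝ qᵐ ⟩
      (q + m) * qᵐ * (N * qᵝ)                         ≤⟨ *-monoˡ-≤ (N * qᵝ) (q+m*q^m≤q*[1+q]^m q m) ⟩
      q * Kᵐ * (N * qᵝ)                               ≡⟨ cong (q * Kᵐ *_) (avoidingWeight-formula b) ⟨
      q * Kᵐ * (Zb * Kᵝ)                              ≡⟨ merge q Kᵐ Zb Kᵝ ⟩
      q * (Zb * (Kᵝ * Kᵐ))                            ≡⟨ cong (λ x → q * (Zb * x)) (^-distribˡ-+-* (suc q) β m) ⟨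
      q * (Zb * suc q ^ (β + m))                      ≤⟨ *-monoʳ-≤ q (*-monoˡ-≤ (suc q ^ (β + m)) (avoidingWeight≤separatingWeight+avoidingWeight a b)) ⟩
      q * ((W + Zab) * suc q ^ (β + m))               ≡⟨ cong (q *_) (*-distribʳ-+ (suc q ^ (β + m)) W Zab) ⟩
      q * (W * suc q ^ (β + m) + Zab * suc q ^ (β + m))
                                                      ≡⟨ cong (λ x → q * (W * suc q ^ (β + m) + x)) Zab-formula ⟩
      q * (W * suc q ^ (β + m) + N * q ^ (β + m))     ≡⟨ *-distribˡ-+ q _ _ ⟩
      q * (W * suc q ^ (β + m)) + q * (N * q ^ (β + m))
                                                      ≡⟨ +-comm (q * (W * suc q ^ (β + m))) _ ⟩
      q * (N * q ^ (β + m)) + q * (W * suc q ^ (β + m)) ∎))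
    where
    open ≤-Reasoning
    N W Zb Zab β m qᵝ qᵐ Kᵝ Kᵐ : ℕ
    N   = suc q ^ n
    W   = separatingWeight (a , b)
    Zb  = avoidingWeight b
    Zab = avoidingWeight (a ∪ b)
    β   = ∣ b ∣
    m   = ∣ a ─ b ∣
    qᵝ  = q ^ β
    qᵐ  = q ^ m
    Kᵝ  = suc q ^ β
    Kᵐ  = suc q ^ m
    ∣a∪b∣≡β+m : ∣ a ∪ b ∣ ≡ β + m
    ∣a∪b∣≡β+m = ∣p∪q∣≡∣q∣+∣p─q∣ a b
    Zab-formula : Zab * suc q ^ (β + m) ≡ N * q ^ (β + m)
    Zab-formula = subst (λ r → Zab * suc q ^ r ≡ N * q ^ r) ∣a∪b∣≡β+m (avoidingWeight-formula (a ∪ b))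
    split : ∀ q m N x y → q * (N * (x * y)) + m * (N * (x * y)) ≡ (q + m) * y * (N * x)
    split = solve-∀
    merge : ∀ q k z l → q * k * (z * l) ≡ q * (z * (l * k))
    merge = solve-∀

  separatingWeight-∣a─b∣ : ∀ {n} (a b : Subset n) → 2 * ∣ a ∪ b ∣ ≤ suc q →
    suc q ^ n * ∣ a ─ b ∣ ≤ 2 * suc q * separatingWeight (a , b)
  separatingWeight-∣a─b∣ {n} a b 2∣a∪b∣≤1+q = *-cancelʳ-≤ (N * m) (2 * suc q * W) (suc q ^ r) {{m^n≢0 (suc q) r}} (begin
    N * m * suc q ^ r               ≤⟨ *-monoʳ-≤ (N * m) ([1+q]^m≤2*q^m q r 2∣a∪b∣≤1+q) ⟩
    N * m * (2 * q ^ r)             ≡⟨ rearrange N m (q ^ r) ⟩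
    2 * (m * (N * q ^ r))           ≤⟨ *-monoʳ-≤ 2 (separatingWeight-gain a b) ⟩
    2 * (q * (W * suc q ^ r))       ≤⟨ *-monoʳ-≤ 2 (*-monoˡ-≤ (W * suc q ^ r) (n≤1+n q)) ⟩
    2 * (suc q * (W * suc q ^ r))   ≡⟨ rearrange′ (suc q) W (suc q ^ r) ⟩
    2 * suc q * W * suc q ^ r       ∎)
    where
    open ≤-Reasoning
    N W m r : ℕ
    N = suc q ^ n
    W = separatingWeight (a , b)
    m = ∣ a ─ b ∣
    r = ∣ a ∪ b ∣
    rearrange : ∀ N m x → N * m * (2 * x) ≡ 2 * (m * (N * x))
    rearrange = solve-∀
    rearrange′ : ∀ k w x → 2 * (k * (w * x)) ≡ 2 * k * w * x
    rearrange′ = solve-∀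

  separatingWeight-sym : ∀ {n} (a b : Subset n) → separatingWeight (b , a) ≡ separatingWeight (a , b)
  separatingWeight-sym a b = weightedSum-cong (λ τ → cong indicator (≢?-sym (response τ b) (response τ a)))
    where
    ≢?-sym : ∀ x y → does (¬? (x Bool.≟ y)) ≡ does (¬? (y Bool.≟ x))
    ≢?-sym true  true  = refl
    ≢?-sym true  false = refl
    ≢?-sym false true  = refl
    ≢?-sym false false = refl

  separatingWeight-distance : ∀ {n} (a b : Subset n) → 2 * ∣ a ∪ b ∣ ≤ suc q →
    suc q ^ n * distance a b ≤ 4 * suc q * separatingWeight (a , b)
  separatingWeight-distance {n} a b 2∣a∪b∣≤1+q = begin
    suc q ^ n * (∣ a ─ b ∣ + ∣ b ─ a ∣)                    ≡⟨ *-distribˡ-+ (suc q ^ n) ∣ a ─ b ∣ ∣ b ─ a ∣ ⟩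
    suc q ^ n * ∣ a ─ b ∣ + suc q ^ n * ∣ b ─ a ∣          ≤⟨ +-mono-≤ (separatingWeight-∣a─b∣ a b 2∣a∪b∣≤1+q) b─a-bound ⟩
    2 * suc q * W + 2 * suc q * W                          ≡⟨ double (suc q) W ⟩
    4 * suc q * W                                          ∎
    where
    open ≤-Reasoning
    W : ℕ
    W = separatingWeight (a , b)
    b─a-bound : suc q ^ n * ∣ b ─ a ∣ ≤ 2 * suc q * W
    b─a-bound = subst (λ w → suc q ^ n * ∣ b ─ a ∣ ≤ 2 * suc q * w) (separatingWeight-sym a b)
      (separatingWeight-∣a─b∣ b a (subst (λ u → 2 * ∣ u ∣ ≤ suc q) (∪-comm a b) 2∣a∪b∣≤1+q))
    double : ∀ k w → 2 * k * w + 2 * k * w ≡ 4 * k * w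
    double = solve-∀

  Detectable : ∀ {n} → ℕ → Pred (Subset n × Subset n) 0ℓ
  Detectable t (a , b) = 2 * ∣ a ∪ b ∣ ≤ suc q × t ≤ distance a b

  separatingWeight-count : ∀ {n} t (P : List (Subset n × Subset n)) → All (Detectable t) P →
    suc q ^ n * (length P * t) ≤ 4 * suc q * weightedSum (λ τ → length (filter (separates? τ) P))
  separatingWeight-count {n} t [] [] = ≤-trans (≤-reflexive (*-zeroʳ (suc q ^ n))) z≤n
  separatingWeight-count {n} t ((a , b) ∷ P) ((small , t≤d) ∷ detectable) = begin
    suc q ^ n * (t + length P * t)                         ≡⟨ *-distribˡ-+ (suc q ^ n) t (length P * t) ⟩
    suc q ^ n * t + suc q ^ n * (length P * t)             ≤⟨ +-mono-≤ (≤-trans (*-monoʳ-≤ (suc q ^ n) t≤d) (separatingWeight-distance a b small))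
                                                                       (separatingWeight-count t P detectable) ⟩
    4 * suc q * separatingWeight (a , b) + 4 * suc q * C   ≡⟨ *-distribˡ-+ (4 * suc q) (separatingWeight (a , b)) C ⟨
    4 * suc q * (separatingWeight (a , b) + C)             ≡⟨ cong (4 * suc q *_) (weightedSum-+ {n} _ _) ⟨
    4 * suc q * weightedSum (λ τ → indicator (does (separates? τ (a , b))) + length (filter (separates? τ) P))
                                                           ≡⟨ cong (4 * suc q *_) (weightedSum-cong (λ τ → length-filter-∷ (separates? τ) P)) ⟨
    4 * suc q * weightedSum (λ τ → length (filter (separates? τ) ((a , b) ∷ P))) ∎
    where
    open ≤-Reasoning
    C : ℕ
    C = weightedSum (λ τ → length (filter (separates? τ) P))

  separating-test : ∀ {n} t (P : List (Subset n × Subset n)) → All (Detectable t) P →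
    ∃ λ τ → length P * t ≤ length (filter (separates? τ) P) * (4 * suc q)
  separating-test {n} t P detectable with weightedSum≤max (λ τ → length (filter (separates? τ) P))
  ... | τ , ws≤ = τ , *-cancelˡ-≤ (suc q ^ n) {{m^n≢0 (suc q) n}} (begin
    suc q ^ n * (length P * t)                            ≤⟨ separatingWeight-count t P detectable ⟩
    4 * suc q * weightedSum (λ τ → length (filter (separates? τ) P))
                                                          ≤⟨ *-monoʳ-≤ (4 * suc q) ws≤ ⟩
    4 * suc q * (suc q ^ n * c)                           ≡⟨ x∙yz≈y∙xz (4 * suc q) (suc q ^ n) c ⟩
    suc q ^ n * (4 * suc q * c)                           ≡⟨ cong (suc q ^ n *_) (*-comm (4 * suc q) c) ⟩
    suc q ^ n * (c * (4 * suc q))                         ∎)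
    where
    open ≤-Reasoning
    c : ℕ
    c = length (filter (separates? τ) P)

-- Greedy covering

length-filter+length-filter-∁ : ∀ {A : Set} {P : Pred A 0ℓ} (P? : Decidable P) xs →
  length (filter P? xs) + length (filter (∁? P?) xs) ≡ length xs
length-filter+length-filter-∁ P? []       = refl
length-filter+length-filter-∁ P? (x ∷ xs) with does (P? x)
... | true  = cong suc (length-filter+length-filter-∁ P? xs)
... | false = trans (+-suc _ _) (cong suc (length-filter+length-filter-∁ P? xs))

module GreedyCover {A X : Set} {Covers : X → Pred A 0ℓ} (covers? : ∀ x → Decidable (Covers x))
  {Good : Pred A 0ℓ} (t M L : ℕ) .{{_ : NonZero M}} (M≤L*t : M ≤ L * t)
  (good-test : ∀ P → All Good P → ∃ λ x → length P * t ≤ length (filter (covers? x) P) * M)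
  where

  CoveredBy : List X → Pred A 0ℓ
  CoveredBy xs p = Any (λ x → Covers x p) xs

  -- Each round covers a fraction t / M of what is left; `shrinks` is the linear form of
  -- (1 - t / M) ^ i ≤ M / (M + i t).
  record Rounds (i : ℕ) (P : List A) : Set where
    field
      tests                : List X
      remaining            : List A
      length-tests         : length tests ≡ i
      remaining-good       : All Good remaining
      covered-or-remaining : ∀ {p} → p ∈ P → CoveredBy tests p ⊎ p ∈ remaining
      shrinks              : i * length remaining * t + length remaining * M ≤ length P * M

  rounds : ∀ i P → All Good P → Rounds i P
  rounds zero P good = record
    { tests = [] ; remaining = P ; length-tests = refl ; remaining-good = good
    ; covered-or-remaining = inj₂ ; shrinks = ≤-refl }
  rounds (suc i) P good = record
    { tests = x ∷ R.tests ; remaining = R.remaining ; length-tests = cong suc R.length-tests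
    ; remaining-good = R.remaining-good ; covered-or-remaining = covered ; shrinks = shrinks }
    where
    x : X
    x = proj₁ (good-test P good)
    P′ : List A
    P′ = filter (∁? (covers? x)) P
    module R = Rounds (rounds i P′ (All.filter⁺ (∁? (covers? x)) good))
    covered : ∀ {p} → p ∈ P → CoveredBy (x ∷ R.tests) p ⊎ p ∈ R.remaining
    covered {p} p∈P with covers? x p
    ... | yes covers = inj₁ (here covers)
    ... | no  misses = Sum.map₁ there (R.covered-or-remaining (∈-filter⁺ (∁? (covers? x)) p∈P misses))
    a b δ : ℕ
    a = length R.remaining
    b = length P′
    δ = length (filter (covers? x) P)
    δ+b≡|P| : δ + b ≡ length P
    δ+b≡|P| = length-filter+length-filter-∁ (covers? x) P
    a≤b : a ≤ b
    a≤b = *-cancelʳ-≤ a b M (≤-trans (m≤n+m (a * M) (i * a * t)) R.shrinks)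
    shrinks : suc i * a * t + a * M ≤ length P * M
    shrinks = begin
      suc i * a * t + a * M          ≡⟨ peel i a t M ⟩
      a * t + (i * a * t + a * M)    ≤⟨ +-mono-≤ (*-monoˡ-≤ t (≤-trans a≤b (m≤n+m b δ))) R.shrinks ⟩
      (δ + b) * t + b * M            ≤⟨ +-monoˡ-≤ (b * M) (≤-trans (≤-reflexive (cong (_* t) δ+b≡|P|)) (proj₂ (good-test P good))) ⟩
      δ * M + b * M                  ≡⟨ *-distribʳ-+ M δ b ⟨
      (δ + b) * M                    ≡⟨ cong (_* M) δ+b≡|P| ⟩
      length P * M                   ∎
      where
      open ≤-Reasoning
      peel : ∀ i a t M → suc i * a * t + a * M ≡ a * t + (i * a * t + a * M)
      peel = solve-∀

  halves : ∀ P (R : Rounds L P) → 2 * length (Rounds.remaining R) ≤ length P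
  halves P R = *-cancelʳ-≤ (2 * a) (length P) M (begin
    2 * a * M              ≡⟨ twice a M ⟩
    a * M + a * M          ≤⟨ +-monoˡ-≤ (a * M) (≤-trans (*-monoʳ-≤ a M≤L*t) (≤-reflexive (reorder a L t))) ⟩
    L * a * t + a * M      ≤⟨ Rounds.shrinks R ⟩
    length P * M           ∎)
    where
    open ≤-Reasoning
    a : ℕ
    a = length (Rounds.remaining R)
    twice : ∀ a M → 2 * a * M ≡ a * M + a * M
    twice = solve-∀
    reorder : ∀ a L t → a * (L * t) ≡ L * a * t
    reorder = solve-∀

  record Covering (j : ℕ) (P : List A) : Set where
    field
      tests        : List X
      length-tests : length tests ≤ L * j
      covers-all   : ∀ {p} → p ∈ P → CoveredBy tests p

  covering : ∀ j P → All Good P → length P < 2 ^ j → Covering j P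
  covering zero    []      _    _           = record { tests = [] ; length-tests = z≤n ; covers-all = λ () }
  covering zero    (_ ∷ _) _    (s≤s ())
  covering (suc j) P       good |P|<2^[1+j] = record
    { tests = R.tests ++ C.tests ; length-tests = length-tests ; covers-all = covers-all }
    where
    R : Rounds L P
    R = rounds L P good
    module R = Rounds R
    module C = Covering (covering j R.remaining R.remaining-good
      (*-cancelˡ-< 2 (length R.remaining) (2 ^ j) (≤-<-trans (halves P R) |P|<2^[1+j])))
    length-tests : length (R.tests ++ C.tests) ≤ L * suc j
    length-tests = begin
      length (R.tests ++ C.tests)        ≡⟨ length-++ R.tests ⟩
      length R.tests + length C.tests    ≤⟨ +-mono-≤ (≤-reflexive R.length-tests) C.length-tests ⟩
      L + L * j                          ≡⟨ *-suc L j ⟨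
      L * suc j                          ∎
      where open ≤-Reasoning
    covers-all : ∀ {p} → p ∈ P → CoveredBy (R.tests ++ C.tests) p
    covers-all p∈P =
      [ Any.++⁺ˡ , (λ p∈rest → Any.++⁺ʳ R.tests (C.covers-all p∈rest)) ]′ (R.covered-or-remaining p∈P)

-- Separating families

pairsOf : ∀ {A : Set} → List A → List (A × A)
pairsOf []       = []
pairsOf (x ∷ xs) = map (x ,_) xs ++ pairsOf xs

∈-pairsOf : ∀ {A : Set} {a b : A} xs → a ∈ xs → b ∈ xs →
  a ≡ b ⊎ (a , b) ∈ pairsOf xs ⊎ (b , a) ∈ pairsOf xs
∈-pairsOf (x ∷ xs) (here refl) (here refl) = inj₁ refl
∈-pairsOf (x ∷ xs) (here refl) (there b∈) = inj₂ (inj₁ (∈-++⁺ˡ (∈-map⁺ (x ,_) b∈)))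
∈-pairsOf (x ∷ xs) (there a∈) (here refl) = inj₂ (inj₂ (∈-++⁺ˡ (∈-map⁺ (x ,_) a∈)))
∈-pairsOf (x ∷ xs) (there a∈) (there b∈) =
  Sum.map₂ (Sum.map (∈-++⁺ʳ (map (x ,_) xs)) (∈-++⁺ʳ (map (x ,_) xs))) (∈-pairsOf xs a∈ b∈)

length-pairsOf : ∀ {A : Set} (xs : List A) → length (pairsOf xs) + length xs ≤ length xs * length xs
length-pairsOf []       = z≤n
length-pairsOf (x ∷ xs) = begin
  length (map (x ,_) xs ++ pairsOf xs) + suc N   ≡⟨ cong (_+ suc N) (trans (length-++ (map (x ,_) xs)) (cong (_+ p) (length-map (x ,_) xs))) ⟩
  N + p + suc N                                  ≡⟨ regroup N p ⟩
  suc (N + (p + N))                              ≤⟨ s≤s (+-monoʳ-≤ N (length-pairsOf xs)) ⟩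
  suc (N + N * N)                                ≤⟨ m≤n+m _ N ⟩
  N + suc (N + N * N)                            ≡⟨ square N ⟩
  suc N * suc N                                  ∎
  where
  open ≤-Reasoning
  N p : ℕ
  N = length xs
  p = length (pairsOf xs)
  regroup : ∀ N p → N + p + suc N ≡ suc (N + (p + N))
  regroup = solve-∀
  square : ∀ N → N + suc (N + N * N) ≡ suc N * suc N
  square = solve-∀

length-pairsOf< : ∀ {A : Set} (xs : List A) k → length xs ≤ 2 ^ k → length (pairsOf xs) < 2 ^ (2 * k)
length-pairsOf< []       k _         = m^n>0 2 (2 * k)
length-pairsOf< (x ∷ xs) k |xs|≤2^k = begin-strict
  p                        <⟨ m<m+n p z<s ⟩
  p + length (x ∷ xs)      ≤⟨ length-pairsOf (x ∷ xs) ⟩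
  length (x ∷ xs) * length (x ∷ xs)  ≤⟨ *-mono-≤ |xs|≤2^k |xs|≤2^k ⟩
  2 ^ k * 2 ^ k            ≡⟨ ^-distribˡ-+-* 2 k k ⟨
  2 ^ (k + k)              ≡⟨ cong (λ j → 2 ^ (k + j)) (+-identityʳ k) ⟨
  2 ^ (2 * k)              ∎
  where
  open ≤-Reasoning
  p : ℕ
  p = length (pairsOf (x ∷ xs))

record SeparatingFamily {n} (D t : ℕ) (F : List (Subset n)) (size : ℕ) : Set where
  field
    tests        : List (Subset n)
    length-tests : length tests ≤ size
    separates    : ∀ {a b} → a ∈ F → b ∈ F → ∣ a ∣ ≤ D → ∣ b ∣ ≤ D → t ≤ distance a b → Separated tests a b

separatingFamily : ∀ {n} D t L → 8 + 16 * D ≤ L * t → (F : List (Subset n)) →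
  SeparatingFamily D t F (L * (2 * ⌈log₂ length F ⌉))
separatingFamily {n} D t L 8+16D≤L*t F = record
  { tests = C.tests ; length-tests = C.length-tests ; separates = separated-if-covered C.covers-all }
  where
  q k : ℕ
  q = 4 * D + 1
  k = ⌈log₂ length F ⌉

  detectable? : Decidable (Detectable q t)
  detectable? (a , b) = (2 * ∣ a ∪ b ∣ ≤? suc q) ×-dec (t ≤? distance a b)

  detectable : ∀ {a b} → ∣ a ∣ ≤ D → ∣ b ∣ ≤ D → t ≤ distance a b → Detectable q t (a , b)
  detectable {a} {b} ∣a∣≤D ∣b∣≤D t≤d = (begin
    2 * ∣ a ∪ b ∣     ≤⟨ *-monoʳ-≤ 2 (≤-trans (∣p∪q∣≤∣p∣+∣q∣ a b) (+-mono-≤ ∣a∣≤D ∣b∣≤D)) ⟩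
    2 * (D + D)       ≡⟨ twice-twice D ⟩
    4 * D             ≤⟨ m≤m+n (4 * D) 2 ⟩
    4 * D + 2         ≡⟨ +-suc (4 * D) 1 ⟩
    suc q             ∎) , t≤d
    where
    open ≤-Reasoning
    twice-twice : ∀ D → 2 * (D + D) ≡ 4 * D
    twice-twice = solve-∀

  good-test : ∀ P → All (Detectable q t) P → ∃ λ τ → length P * t ≤ length (filter (separates? τ) P) * (8 + 16 * D)
  good-test P detectable-P = subst (λ M → ∃ λ τ → length P * t ≤ length (filter (separates? τ) P) * M)
    (four-times D) (separating-test q t P detectable-P)
    where
    four-times : ∀ D → 4 * suc (4 * D + 1) ≡ 8 + 16 * D
    four-times = solve-∀

  open GreedyCover separates? {Good = Detectable q t} t (8 + 16 * D) L 8+16D≤L*t good-test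

  P : List (Subset n × Subset n)
  P = filter detectable? (pairsOf F)

  module C = Covering (covering (2 * k) P (All.all-filter detectable? (pairsOf F))
    (≤-<-trans (length-filter detectable? (pairsOf F)) (length-pairsOf< F k (n≤2^⌈log₂n⌉ (length F)))))

  separated-if-covered : ∀ {τs} → (∀ {p} → p ∈ P → CoveredBy τs p) →
    ∀ {a b} → a ∈ F → b ∈ F → ∣ a ∣ ≤ D → ∣ b ∣ ≤ D → t ≤ distance a b → Separated τs a b
  separated-if-covered covered {a} {b} a∈F b∈F ∣a∣≤D ∣b∣≤D t≤d with ∈-pairsOf F a∈F b∈F
  ... | inj₁ refl with () ← ≤-trans 8+16D≤L*t (≤-reflexive (trans (cong (L *_) (n≤0⇒n≡0 (subst (t ≤_) (distance-self a) t≤d))) (*-zeroʳ L)))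
  ... | inj₂ (inj₁ ab∈) = covered (∈-filter⁺ detectable? ab∈ (detectable {a} {b} ∣a∣≤D ∣b∣≤D t≤d))
  ... | inj₂ (inj₂ ba∈) = Any.map ≢-sym (covered (∈-filter⁺ detectable? ba∈
          (detectable {b} {a} ∣b∣≤D ∣a∣≤D (subst (t ≤_) (+-comm ∣ a ─ b ∣ ∣ b ─ a ∣) t≤d))))

-- The two-stage algorithm

elements : ∀ {n} → Subset n → List (Fin n)
elements []          = []
elements (true  ∷ p) = fzero ∷ map fsuc (elements p)
elements (false ∷ p) = map fsuc (elements p)

length-elements : ∀ {n} (p : Subset n) → length (elements p) ≡ ∣ p ∣
length-elements []          = refl
length-elements (true  ∷ p) = cong suc (trans (length-map fsuc (elements p)) (length-elements p))
length-elements (false ∷ p) = trans (length-map fsuc (elements p)) (length-elements p)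

∈-elements : ∀ {n} {x : Fin n} {p} → x ∈ₛ p → x ∈ elements p
∈-elements {p = true ∷ p}  here        = here refl
∈-elements {p = true ∷ p}  (there x∈p) = there (∈-map⁺ fsuc (∈-elements x∈p))
∈-elements {p = false ∷ p} (there x∈p) = ∈-map⁺ fsuc (∈-elements x∈p)

head-filter : ∀ {A : Set} {P : Pred A 0ℓ} (P? : Decidable P) {x} xs → x ∈ xs → P x →
  ∃ λ y → head (filter P? xs) ≡ just y × y ∈ xs × P y
head-filter P? xs x∈xs Px with filter P? xs in filtered
... | []    with () ← subst (_ ∈_) filtered (∈-filter⁺ P? x∈xs Px)
... | y ∷ _ = y , refl , ∈-filter⁻ P? (subst (y ∈_) (sym filtered) (here refl))

noTests : ∀ {n} → Subset n → TwoStage n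
noTests e = record { m₁ = 0 ; stage1 = [] ; m₂ = λ _ → 0 ; stage2 = λ _ → [] ; decode = λ _ _ → e }

module TwoStageTesting {n} (d : ℕ) .{{_ : NonZero d}} (E : List (Subset n))
                       (E-small : All (λ e → ∣ e ∣ ≤ d) E) where

  s k : ℕ
  s = ceilSqrt d
  k = ⌈log₂ length E ⌉

  1≤s : 1 ≤ s
  1≤s = positive (ceilSqrt-sq d)
    where
    positive : ∀ {x} → d ≤ x * x → 1 ≤ x
    positive {zero}  d≤0 with () ← <-≤-trans (>-nonZero⁻¹ d) d≤0
    positive {suc x} _   = s≤s z≤n

  _≟ᵛ_ : ∀ {m} → DecidableEquality (Vec Bool m)
  _≟ᵛ_ = ≡-dec Bool._≟_

  8+16d≤24s*s : 8 + 16 * d ≤ 24 * s * s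
  8+16d≤24s*s = begin
    8 + 16 * d         ≤⟨ +-monoˡ-≤ (16 * d) (m≤m*n 8 d) ⟩
    8 * d + 16 * d     ≡⟨ *-distribʳ-+ d 8 16 ⟨
    24 * d             ≤⟨ *-monoʳ-≤ 24 (ceilSqrt-sq d) ⟩
    24 * (s * s)       ≡⟨ *-assoc 24 s s ⟨
    24 * s * s         ∎
    where open ≤-Reasoning

  module S₁ = SeparatingFamily (separatingFamily d s (24 * s) 8+16d≤24s*s E)

  first : Vec (Subset n) (length S₁.tests)
  first = fromList S₁.tests

  candidates : Vec Bool (length S₁.tests) → List (Subset n)
  candidates r = filter (λ e → responses first e ≟ᵛ r) E

  module S₂ (c : Subset n) (F : List (Subset n)) =
    SeparatingFamily (separatingFamily s 1 (8 + 16 * s) (≤-reflexive (sym (*-identityʳ _))) (map (_─ c) (c ∷ F)))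

  stage₂ : List (Subset n) → List (Subset n)
  stage₂ []      = []
  stage₂ (c ∷ F) = map ⁅_⁆ (elements c) ++ map (_─ c) (S₂.tests c F)

  second : (r : Vec Bool (length S₁.tests)) → Vec (Subset n) (length (stage₂ (candidates r)))
  second r = fromList (stage₂ (candidates r))

  consistent? : ∀ r (r₂ : Vec Bool (length (stage₂ (candidates r)))) →
    Decidable (λ e → responses first e ≡ r × responses (second r) e ≡ r₂)
  consistent? r r₂ e = (responses first e ≟ᵛ r) ×-dec (responses (second r) e ≟ᵛ r₂)

  algorithm : TwoStage n
  algorithm = record
    { m₁     = length S₁.tests
    ; stage1 = first
    ; m₂     = λ r → length (stage₂ (candidates r))
    ; stage2 = second
    ; decode = λ r r₂ → fromMaybe ∅ (head (filter (consistent? r r₂) E))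
    }

  ∈-candidates⁺ : ∀ {r x} → x ∈ E → responses first x ≡ r → x ∈ candidates r
  ∈-candidates⁺ {r} = ∈-filter⁺ (λ e → responses first e ≟ᵛ r)

  ∈-candidates⁻ : ∀ {r x} → x ∈ candidates r → x ∈ E × responses first x ≡ r
  ∈-candidates⁻ {r} = ∈-filter⁻ (λ e → responses first e ≟ᵛ r) {xs = E}

  close-candidates : ∀ {r x y} → x ∈ candidates r → y ∈ candidates r → distance x y < s
  close-candidates {r} {x} {y} x∈ y∈ = ≰⇒> λ s≤d →
    Agree⇒¬Separated agree (S₁.separates x∈E y∈E (All.lookup E-small x∈E) (All.lookup E-small y∈E) s≤d)
    where
    x∈E : x ∈ E
    x∈E = proj₁ (∈-candidates⁻ x∈)
    y∈E : y ∈ E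
    y∈E = proj₁ (∈-candidates⁻ y∈)
    agree : Agree S₁.tests x y
    agree = responses-≡⇒Agree S₁.tests (trans (proj₂ (∈-candidates⁻ x∈)) (sym (proj₂ (∈-candidates⁻ y∈))))

  stage₂-identifies : ∀ F → (∀ {x y} → x ∈ F → y ∈ F → distance x y < s) →
    ∀ {e e′} → e ∈ F → e′ ∈ F → Agree (stage₂ F) e e′ → e ≡ e′
  stage₂-identifies (c ∷ F) close {e} {e′} e∈ e′∈ agree = agree-outside-and-on⇒≡ e e′ c e─c≡e′─c on-c
    where
    module S = S₂ c F
    agree-singletons : Agree (map ⁅_⁆ (elements c)) e e′
    agree-singletons = proj₁ (All.++⁻ (map ⁅_⁆ (elements c)) agree)
    agree-lifted : Agree (map (_─ c) S.tests) e e′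
    agree-lifted = proj₂ (All.++⁻ (map ⁅_⁆ (elements c)) agree)
    on-c : ∀ x → x ∈ₛ c → lookup e x ≡ lookup e′ x
    on-c x x∈c = begin
      lookup e x          ≡⟨ response-⁅⁆ x e ⟨
      response ⁅ x ⁆ e    ≡⟨ All.lookup (All.map⁻ agree-singletons) (∈-elements x∈c) ⟩
      response ⁅ x ⁆ e′   ≡⟨ response-⁅⁆ x e′ ⟩
      lookup e′ x         ∎
      where open ≡-Reasoning
    small : ∀ {x} → x ∈ c ∷ F → ∣ x ─ c ∣ ≤ s
    small x∈ = ≤-trans (m≤m+n _ _) (<⇒≤ (close x∈ (here refl)))
    agree-outside : Agree S.tests (e ─ c) (e′ ─ c)
    agree-outside = All.map (λ {τ} same → trans (sym (response-─ τ c e)) (trans same (response-─ τ c e′)))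
      (All.map⁻ agree-lifted)
    e─c≡e′─c : e ─ c ≡ e′ ─ c
    e─c≡e′─c = distance≡0⇒≡ (e ─ c) (e′ ─ c) (n<1⇒n≡0 (≰⇒> λ 1≤d → Agree⇒¬Separated agree-outside
      (S.separates (∈-map⁺ (_─ c) e∈) (∈-map⁺ (_─ c) e′∈) (small e∈) (small e′∈) 1≤d)))

  identifies : ∀ {e e′} → e ∈ E → e′ ∈ E → responses first e′ ≡ responses first e →
    responses (second (responses first e)) e′ ≡ responses (second (responses first e)) e → e′ ≡ e
  identifies {e} {e′} e∈E e′∈E same₁ same₂ =
    stage₂-identifies (candidates (responses first e)) close-candidates
      (∈-candidates⁺ e′∈E same₁) (∈-candidates⁺ e∈E refl) (responses-≡⇒Agree _ same₂)

  finds : Finds algorithm E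
  finds e e∈E =
    let y , head≡y , y∈E , same₁ , same₂ = head-filter (consistent? r r₂) E e∈E (refl , refl)
    in trans (cong (fromMaybe ∅) head≡y) (identifies e∈E y∈E same₁ same₂)
    where
    r : Vec Bool (length S₁.tests)
    r = responses first e
    r₂ : Vec Bool (length (stage₂ (candidates r)))
    r₂ = responses (second r) e

  stage₂-length : ∀ F → (∀ {x} → x ∈ F → ∣ x ∣ ≤ d) → length F ≤ length E →
    length (stage₂ F) ≤ d + (8 + 16 * s) * (2 * k)
  stage₂-length []      _     _         = z≤n
  stage₂-length (c ∷ F) small |c∷F|≤|E| = begin
    length (map ⁅_⁆ (elements c) ++ map (_─ c) S.tests)
      ≡⟨ length-++ (map ⁅_⁆ (elements c)) ⟩
    length (map ⁅_⁆ (elements c)) + length (map (_─ c) S.tests)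
      ≡⟨ cong₂ _+_ (trans (length-map ⁅_⁆ (elements c)) (length-elements c)) (length-map (_─ c) S.tests) ⟩
    ∣ c ∣ + length S.tests
      ≤⟨ +-mono-≤ (small (here refl)) (≤-trans S.length-tests (*-monoʳ-≤ (8 + 16 * s) (*-monoʳ-≤ 2 log-bound))) ⟩
    d + (8 + 16 * s) * (2 * k)
      ∎
    where
    open ≤-Reasoning
    module S = S₂ c F
    log-bound : ⌈log₂ length (map (_─ c) (c ∷ F)) ⌉ ≤ k
    log-bound = ⌈log₂⌉-mono-≤ (subst (_≤ length E) (sym (length-map (_─ c) (c ∷ F))) |c∷F|≤|E|)

  numTests-bound : ∀ e → e ∈ E → numTests algorithm e ≤ 96 * (s * k + d)
  numTests-bound e _ = begin
    length S₁.tests + length (stage₂ (candidates r))   ≤⟨ +-mono-≤ S₁.length-tests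
                                                            (stage₂-length (candidates r) small (length-filter _ E)) ⟩
    24 * s * (2 * k) + (d + (8 + 16 * s) * (2 * k))    ≡⟨ expand s k d ⟩
    80 * (s * k) + 16 * k + d                          ≤⟨ +-monoˡ-≤ d (+-monoʳ-≤ (80 * (s * k)) (*-monoʳ-≤ 16 k≤s*k)) ⟩
    80 * (s * k) + 16 * (s * k) + d                    ≡⟨ collect (s * k) d ⟩
    96 * (s * k) + d                                   ≤⟨ +-monoʳ-≤ (96 * (s * k)) (m≤n*m d 96) ⟩
    96 * (s * k) + 96 * d                              ≡⟨ *-distribˡ-+ 96 (s * k) d ⟨
    96 * (s * k + d)                                   ∎
    where
    open ≤-Reasoning
    r : Vec Bool (length S₁.tests)
    r = responses first e
    small : ∀ {x} → x ∈ candidates r → ∣ x ∣ ≤ d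
    small x∈ = All.lookup E-small (proj₁ (∈-candidates⁻ x∈))
    k≤s*k : k ≤ s * k
    k≤s*k = subst (_≤ s * k) (*-identityˡ k) (*-monoˡ-≤ k 1≤s)
    expand : ∀ s k d → 24 * s * (2 * k) + (d + (8 + 16 * s) * (2 * k)) ≡ 80 * (s * k) + 16 * k + d
    expand = solve-∀
    collect : ∀ x d → 80 * x + 16 * x + d ≡ 96 * x + d
    collect = solve-∀

corollary4 : ∃ λ (C : ℕ) → ∀ (n d : ℕ) (E : List (Subset n)) → Unique E → All (λ e → ∣ e ∣ ≤ d) E →
    Σ (TwoStage n) λ A → Finds A E ×
      (∀ e → e ∈ E → numTests A e ≤ C * (ceilSqrt d * ⌈log₂ length E ⌉ + d))
corollary4 = 96 , construction
  where
  construction : ∀ n d (E : List (Subset n)) → Unique E → All (λ e → ∣ e ∣ ≤ d) E →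
    Σ (TwoStage n) λ A → Finds A E × (∀ e → e ∈ E → numTests A e ≤ 96 * (ceilSqrt d * ⌈log₂ length E ⌉ + d))
  -- Unique E is not needed: equal entries of E never have to be separated.
  construction n zero    E _ E-empty =
    noTests ∅ , (λ e e∈E → sym (∣p∣≤0⇒p≡∅ e (All.lookup E-empty e∈E))) , λ _ _ → z≤n
  construction n (suc d) E _ E-small = algorithm , finds , numTests-bound
    where open TwoStageTesting (suc d) E E-small
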